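{- Let $n$ and $m$ be integers such that $m$ is even and $6\leq m\leq 2n-2$. Then $$R(K_{1,n},W_m)\geq\begin{cases}2n+m/2-1, & \text{if both } n \text{ and } m/2 \text{ are even};\\ 2n+m/2, & \text{otherwise.}\end{cases}$$
   Context: All graphs are finite and simple. For graphs $G_1,G_2$, the Ramsey number $R(G_1,G_2)$ is the least integer $r$ such that for every graph $G$ on $r$ vertices, either $G$ contains a subgraph isomorphic to $G_1$ or the complement $\overline{G}$ contains a subgraph isomorphic to $G_2$. $K_{1,n}$ is the star with $n$ leaves. For $m\geq 3$, the wheel $W_m$ is the graph on $m+1$ vertices obtained from a cycle $C_m$ by adding one new vertex adjacent to all vertices of the cycle. -}

module Defs where

open import Data.Nat using (ℕ; zero; suc; _+_; _≡ᵇ_)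
open import Data.Fin using (Fin; zero; suc; toℕ)
open import Data.Product using (Σ; _×_; _,_)
open import Data.Sum using (_⊎_; inj₁; inj₂)
open import Data.Empty using (⊥)
open import Data.Unit using (⊤)
open import Relation.Nullary using (¬_)
open import Relation.Binary.PropositionalEquality using (_≡_; _≢_; refl; sym)
open import Function.Definitions using (Injective)

record Graph : Set₁ where
  field
    order  : ℕ
    Adj    : Fin order → Fin order → Set
    adj-sym    : ∀ {i j} → Adj i j → Adj j i
    adj-irrefl : ∀ {i} → ¬ Adj i i

open Graph public

complement : Graph → Graph
complement G = record
  { order  = order G
  ; Adj    = λ i j → (i ≢ j) × ¬ Adj G i j
  ; adj-sym    = λ { (i≢j , ¬a) → (λ e → i≢j (sym e)) , (λ a → ¬a (adj-sym G a)) }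
  ; adj-irrefl = λ { (i≢i , _) → i≢i refl }
  }

Contains : Graph → Graph → Set
Contains G H = Σ (Fin (order H) → Fin (order G)) λ f →
  Injective _≡_ _≡_ f × (∀ i j → Adj H i j → Adj G (f i) (f j))

-- r has the Ramsey property for (G₁, G₂): every graph on r vertices contains G₁
-- or its complement contains G₂.  R(G₁,G₂) is the least such r.
RamseyProp : Graph → Graph → ℕ → Set₁
RamseyProp G₁ G₂ r = ∀ (G : Graph) → order G ≡ r → Contains G G₁ ⊎ Contains (complement G) G₂

StarAdj : ∀ {n} → Fin (suc n) → Fin (suc n) → Set
StarAdj zero    zero    = ⊥
StarAdj zero    (suc _) = ⊤
StarAdj (suc _) zero    = ⊤
StarAdj (suc _) (suc _) = ⊥

Star : ℕ → Graph
Star n = record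
  { order = suc n ; Adj = StarAdj ; adj-sym = s ; adj-irrefl = ir }
  where
    s : ∀ {i j : Fin (suc n)} → StarAdj i j → StarAdj j i
    s {zero} {suc _} a = a
    s {suc _} {zero} a = a
    ir : ∀ {i : Fin (suc n)} → ¬ StarAdj i i
    ir {zero} ()
    ir {suc _} ()

-- Cycle C_m on Fin m: i ~ j iff j = i+1 mod m or i = j+1 mod m (for m ≥ 3 this is C_m).
Succ : ℕ → ℕ → ℕ → Set
Succ m a b = (suc a ≡ b) ⊎ ((suc a ≡ m) × (b ≡ 0))

CycAdj : ∀ {m} → Fin m → Fin m → Set
CycAdj {m} i j = (Succ m (toℕ i) (toℕ j) ⊎ Succ m (toℕ j) (toℕ i)) × (i ≢ j)

WheelAdj : ∀ {m} → Fin (suc m) → Fin (suc m) → Set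
WheelAdj zero    zero    = ⊥
WheelAdj zero    (suc _) = ⊤
WheelAdj (suc _) zero    = ⊤
WheelAdj (suc i) (suc j) = CycAdj i j

Wheel : ℕ → Graph
Wheel m = record
  { order = suc m ; Adj = WheelAdj ; adj-sym = s ; adj-irrefl = ir }
  where
    s : ∀ {i j : Fin (suc m)} → WheelAdj i j → WheelAdj j i
    s {zero} {suc _} a = a
    s {suc _} {zero} a = a
    s {suc _} {suc _} (inj₁ x , ne) = inj₂ x , λ e → ne (sym e)
    s {suc _} {suc _} (inj₂ x , ne) = inj₁ x , λ e → ne (sym e)
    ir : ∀ {i : Fin (suc m)} → ¬ WheelAdj i i
    ir {zero} ()
    ir {suc _} (_ , ne) = ne refl

-- Write k = m/2 = d + 1.  Call a graph F a spread of degree d if it is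
-- d-regular and its vertices split into parts, closed under adjacency, with
-- fewer than 2k vertices each.  If F is such a spread on a ≤ n + d vertices,
-- let G be a clique K_n beside the complement of F.  Every vertex of G has at
-- most n − 1 neighbours, so G contains no K_{1,n}.  The complement of G is F
-- joined to an independent n-set, and it contains no W_{2k}: a wheel centred
-- in the independent set has its rim, a connected set of 2k vertices, inside
-- one part of F; a wheel centred at u ∈ F yields k neighbours of u in F, one
-- from each edge of a perfect matching of the rim.  Hence R > n + a
-- ('lower-bound').
--
-- Spreads are closed under disjoint union ('_⊕_'); K_k is a spread, and so is
-- a bipartite circulant piece on every even number of vertices in [k, 2k).
-- Splitting a into such pieces shows that spreads exist for every a ≥ 2k
-- with a even or k odd ('spread').  The theorem follows with a = n + k − 2
-- when n and k are both even, and a = n + k − 1 otherwise.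

module Submission where

open import Defs
open import Data.Nat using (ℕ; _+_; _*_; _∸_; _≤_; _/_)
open import Data.Nat.Divisibility using (_∣_)
open import Data.Product using (_×_)
open import Relation.Nullary using (¬_)

open import Data.Nat using (zero; suc; _<_; z≤n; s≤s; _≤?_)
open import Data.Nat.Properties hiding (_≟_)
open import Data.Nat.Divisibility using (divides; _∣?_; ∣m+n∣m⇒∣n; ∣m∣n⇒∣m+n; ∣n⇒∣m*n; ∣1⇒≡1; ∣-refl)
open import Data.Nat.DivMod
  using (_%_; _mod_; m%n<n; m≡m%n+[m/n]*n; m*n/n≡m; /-monoˡ-≤; %-distribˡ-+; m%n%n≡m%n;
         [m+n]%n≡m%n; m<n⇒m%n≡m)
open import Data.Nat.Tactic.RingSolver using (solve-∀)
open import Data.Fin using (Fin; splitAt; join; toℕ; inject₁; inject≤; combine; punchIn; _≟_)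
  renaming (zero to fzero; suc to fsuc)
open import Data.Fin.Properties
  renaming (suc-injective to fsuc-injective)
  using (join-splitAt; injective⇒≤; toℕ<n; punchIn-injective; punchInᵢ≢i; toℕ-fromℕ<;
         toℕ-injective; +↔⊎; toℕ-inject₁; toℕ-combine; combine-injectiveˡ; inject≤-injective)
open import Data.Vec.Functional using (_∷_; _++_)
open import Data.Product using (Σ; _,_; proj₁; proj₂)
open import Data.Sum using (_⊎_; inj₁; inj₂; [_,_]′)
import Data.Sum as Sum
open import Data.Sum.Properties using (inj₁-injective; inj₂-injective)
open import Data.Sum.Function.Propositional using (_⊎-↔_)
open import Data.Empty using (⊥; ⊥-elim)
open import Data.Unit using (⊤; tt)
open import Function using (_∘_)
open import Function.Bundles using (_↔_; Injection; Inverse)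
open import Function.Definitions using (Injective)
open import Function.Properties.Inverse using (↔⇒↣; ↔-sym; ↔-refl; ↔-trans)
open import Relation.Nullary using (yes; no)
open import Relation.Nullary.Decidable using (decidable-stable; ¬?)
open import Relation.Binary using (Decidable)
open import Relation.Binary.PropositionalEquality

variable
  A B : Set
  m : ℕ

Distinct : (Fin m → A) → Set
Distinct xs = Injective _≡_ _≡_ xs

∷-distinct : {x : A} {xs : Fin m → A} → Distinct xs → (∀ i → xs i ≢ x) → Distinct (x ∷ xs)
∷-distinct d new {fzero}  {fzero}  _ = refl
∷-distinct d new {fzero}  {fsuc j} e = ⊥-elim (new j (sym e))
∷-distinct d new {fsuc i} {fzero}  e = ⊥-elim (new i e)
∷-distinct d new {fsuc i} {fsuc j} e = cong fsuc (d e)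

++-distinct : ∀ {n} {xs : Fin m → A} {ys : Fin n → A} → Distinct xs → Distinct ys →
  (∀ i j → xs i ≢ ys j) → Distinct (xs ++ ys)
++-distinct {m = m} {n = n} {xs} {ys} dx dy apart {i} {j} e =
  begin
    i                           ≡⟨ join-splitAt m n i ⟨
    join m n (splitAt m i)      ≡⟨ cong (join m n) (on-sum (splitAt m i) (splitAt m j) e) ⟩
    join m n (splitAt m j)      ≡⟨ join-splitAt m n j ⟩
    j                           ∎
  where
  open ≡-Reasoning
  on-sum : ∀ a b → [ xs , ys ]′ a ≡ [ xs , ys ]′ b → a ≡ b
  on-sum (inj₁ a) (inj₁ b) e = cong inj₁ (dx e)
  on-sum (inj₁ a) (inj₂ b) e = ⊥-elim (apart a b e)
  on-sum (inj₂ a) (inj₁ b) e = ⊥-elim (apart b a (sym e))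
  on-sum (inj₂ a) (inj₂ b) e = cong inj₂ (dy e)

++-all : ∀ {n} (P : A → Set) {xs : Fin m → A} {ys : Fin n → A} →
  (∀ i → P (xs i)) → (∀ j → P (ys j)) → ∀ k → P ((xs ++ ys) k)
++-all {m = m} P px py k with splitAt m k
... | inj₁ i = px i
... | inj₂ j = py j

preimage-distinct : (e : A → B) {xs : Fin m → B} (ys : Fin m → A) →
  (∀ i → xs i ≡ e (ys i)) → Distinct xs → Distinct ys
preimage-distinct e ys pre d {i} {j} eq = d (trans (pre i) (trans (cong e eq) (sym (pre j))))

record FinGraph : Set₁ where
  field
    Vertex   : Set
    size     : ℕ
    indexing : Vertex ↔ Fin size
    _~_      : Vertex → Vertex → Set
    ~-sym    : ∀ {u v} → u ~ v → v ~ u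
    ~-irrefl : ∀ {u} → ¬ u ~ u
    _~?_     : Decidable _~_

module _ (F : FinGraph) where
  open FinGraph F

  distinct-≤ : {xs : Fin m → Vertex} → Distinct xs → m ≤ size
  distinct-≤ d = injective⇒≤ (d ∘ Injection.injective (↔⇒↣ indexing))

  Nbrs : Vertex → ℕ → Set
  Nbrs u m = Σ (Fin m → Vertex) λ xs → Distinct xs × (∀ i → u ~ xs i)

  nbr-≢ : ∀ {u} (nb : Nbrs u m) → ∀ i → proj₁ nb i ≢ u
  nbr-≢ {u = u} (xs , _ , adj) i e = ~-irrefl (subst (u ~_) e (adj i))

  degree-< : ∀ {u} → Nbrs u m → m < size
  degree-< nb@(_ , dx , _) = distinct-≤ (∷-distinct dx (nbr-≢ nb))

  degree-bound : ∀ {u s} → Nbrs u m → (ys : Fin s → Vertex) → Distinct ys →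
    (∀ j → ys j ≢ u × ¬ u ~ ys j) → m + s < size
  degree-bound {u = u} (xs , dx , adj) ys dy far =
    distinct-≤ (∷-distinct (++-distinct dx dy apart)
                           (++-all (_≢ u) (nbr-≢ (xs , dx , adj)) (proj₁ ∘ far)))
    where
    apart : ∀ i j → xs i ≢ ys j
    apart i j e = proj₂ (far j) (subst (u ~_) e (adj i))

  record IsSpread (d : ℕ) : Set₁ where
    field
      nbrs       : ∀ u → Nbrs u d
      no-more    : ∀ u → ¬ Nbrs u (suc d)
      Part       : Set
      part       : Vertex → Part
      part-~     : ∀ {u v} → u ~ v → part u ≡ part v
      part-small : ∀ p {m} {xs : Fin m → Vertex} → Distinct xs →
                   (∀ i → part (xs i) ≡ p) → m < suc d * 2

  small-spread : ∀ {d} → size < suc d * 2 → (∀ u → Nbrs u d) → (∀ u → ¬ Nbrs u (suc d)) →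
    IsSpread d
  small-spread size< nbrs no-more = record
    { nbrs = nbrs ; no-more = no-more ; Part = ⊤ ; part = λ _ → tt ; part-~ = λ _ → refl
    ; part-small = λ _ dxs _ → ≤-<-trans (distinct-≤ dxs) size< }

constant-along : ∀ {X : Set} (φ : Fin (suc m) → X) →
  (∀ j → φ (inject₁ j) ≡ φ (fsuc j)) → ∀ i → φ i ≡ φ fzero
constant-along φ step fzero = refl
constant-along {m = suc m} φ step (fsuc i) =
  trans (sym (step i)) (constant-along (φ ∘ inject₁) (step ∘ inject₁) i)

successor-adj : (i j : Fin m) → suc (toℕ i) ≡ toℕ j → CycAdj i j
successor-adj i j e = inj₁ (inj₁ e) , λ i≡j → 1+n≢n (trans e (cong toℕ (sym i≡j)))

cycle-step : (i : Fin m) → CycAdj (inject₁ i) (fsuc i)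
cycle-step i = successor-adj (inject₁ i) (fsuc i) (cong suc (toℕ-inject₁ i))

cycle-matching : (j : Fin m) → CycAdj {m * 2} (combine j fzero) (combine j (fsuc fzero))
cycle-matching j = successor-adj (combine j fzero) (combine j (fsuc fzero)) (begin
    suc (toℕ (combine j fzero))      ≡⟨ cong suc (toℕ-combine j fzero) ⟩
    suc (2 * toℕ j + 0)              ≡⟨ cong suc (+-identityʳ (2 * toℕ j)) ⟩
    suc (2 * toℕ j)                  ≡⟨ +-comm 1 (2 * toℕ j) ⟩
    2 * toℕ j + 1                    ≡⟨ toℕ-combine j (fsuc fzero) ⟨
    toℕ (combine j (fsuc fzero))     ∎)
  where open ≡-Reasoning

-- The Ramsey property at r applies to every graph with at least r vertices
-- (look at the subgraph induced by the first r vertices).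
ramsey-≥ : ∀ {H₁ H₂ r} → RamseyProp H₁ H₂ r → (G : Graph) → r ≤ order G →
  Contains G H₁ ⊎ Contains (complement G) H₂
ramsey-≥ {H₁} {H₂} {r} R G r≤ = Sum.map extend₁ extend₂ (R prefix refl)
  where
  ι : Fin r → Fin (order G)
  ι i = inject≤ i r≤
  ι-distinct : Distinct ι
  ι-distinct = inject≤-injective r≤ r≤ _ _
  prefix : Graph
  prefix = record { order = r ; Adj = λ i j → Adj G (ι i) (ι j)
                  ; adj-sym = adj-sym G ; adj-irrefl = adj-irrefl G }
  extend₁ : Contains prefix H₁ → Contains G H₁
  extend₁ (f , f-inj , hom) = ι ∘ f , f-inj ∘ ι-distinct , hom
  extend₂ : Contains (complement prefix) H₂ → Contains (complement G) H₂
  extend₂ (f , f-inj , hom) =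
    ι ∘ f , f-inj ∘ ι-distinct , λ i j a → proj₁ (hom i j a) ∘ ι-distinct , proj₂ (hom i j a)

record Spread (d a : ℕ) : Set₁ where
  field
    graph    : FinGraph
    isSpread : IsSpread graph d
    has-size : FinGraph.size graph ≡ a

module Witness (n : ℕ) (F : FinGraph) where
  open FinGraph F

  Point : Set
  Point = Fin n ⊎ Vertex

  _—_ : Point → Point → Set
  inj₁ i — inj₁ j = i ≢ j
  inj₁ i — inj₂ v = ⊥
  inj₂ u — inj₁ j = ⊥
  inj₂ u — inj₂ v = u ≢ v × ¬ u ~ v

  —-sym : ∀ x y → x — y → y — x
  —-sym (inj₁ i) (inj₁ j) ne        = ≢-sym ne
  —-sym (inj₂ u) (inj₂ v) (ne , na) = ≢-sym ne , na ∘ ~-sym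

  —-irrefl : ∀ x → ¬ x — x
  —-irrefl (inj₁ i) ne       = ne refl
  —-irrefl (inj₂ u) (ne , _) = ne refl

  points : Point ↔ Fin (n + size)
  points = ↔-trans (↔-refl ⊎-↔ indexing) (↔-sym +↔⊎)

  at : Fin (n + size) → Point
  at = Inverse.from points

  at-distinct : Distinct at
  at-distinct = Injection.injective (↔⇒↣ (↔-sym points))

  G : Graph
  G = record { order = n + size ; Adj = λ i j → at i — at j
             ; adj-sym = λ {i} {j} → —-sym (at i) (at j)
             ; adj-irrefl = λ {i} → —-irrefl (at i) }

  clique-degree : ∀ i (ℓ : Fin n → Point) → Distinct ℓ → ¬ (∀ j → inj₁ i — ℓ j)
  clique-degree i ℓ dℓ adj = 1+n≰n (injective⇒≤ (∷-distinct dys (≢-sym ∘ proj₂ ∘ proj₂ ∘ nbr)))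
    where
    left-nbr : ∀ x → inj₁ i — x → Σ (Fin n) λ b → x ≡ inj₁ b × i ≢ b
    left-nbr (inj₁ b) ne = b , refl , ne
    nbr : ∀ j → Σ (Fin n) λ b → ℓ j ≡ inj₁ b × i ≢ b
    nbr j = left-nbr (ℓ j) (adj j)
    dys : Distinct (proj₁ ∘ nbr)
    dys = preimage-distinct inj₁ (proj₁ ∘ nbr) (proj₁ ∘ proj₂ ∘ nbr) dℓ

  _≁_ : Point → Point → Set
  x ≁ y = x ≢ y × ¬ x — y

  clique-independent : ∀ {i j} → ¬ inj₁ i ≁ inj₁ j
  clique-independent (ne , na) = na (ne ∘ cong inj₁)

  -- … and on F the complement of G is F itself (adjacency of F is decidable).
  ≁⇒~ : ∀ {u v} → inj₂ u ≁ inj₂ v → u ~ v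
  ≁⇒~ {u} {v} (ne , na) = decidable-stable (u ~? v) λ ¬u~v → na (ne ∘ cong inj₂ , ¬u~v)

  module _ {d : ℕ} (S : IsSpread F d) where
    open IsSpread S

    -- A vertex u of F has d neighbours in F, so at most size − d − 1 ≤ n − 1
    -- neighbours in G.
    spread-degree : size ≤ n + d → ∀ u (ℓ : Fin n → Point) → Distinct ℓ → ¬ (∀ j → inj₂ u — ℓ j)
    spread-degree size≤ u ℓ dℓ adj =
      <⇒≱ (degree-bound F (nbrs u) (proj₁ ∘ nbr) dys (proj₂ ∘ proj₂ ∘ nbr))
          (≤-trans size≤ (≤-reflexive (+-comm n d)))
      where
      right-nbr : ∀ x → inj₂ u — x → Σ Vertex λ v → x ≡ inj₂ v × (v ≢ u × ¬ u ~ v)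
      right-nbr (inj₂ v) (ne , na) = v , refl , ≢-sym ne , na
      nbr : ∀ j → Σ Vertex λ v → ℓ j ≡ inj₂ v × (v ≢ u × ¬ u ~ v)
      nbr j = right-nbr (ℓ j) (adj j)
      dys : Distinct (proj₁ ∘ nbr)
      dys = preimage-distinct inj₂ (proj₁ ∘ nbr) (proj₁ ∘ proj₂ ∘ nbr) dℓ

    no-star : size ≤ n + d → ¬ Contains G (Star n)
    no-star size≤ (f , f-inj , hom) = no-centre (at (f fzero)) (λ j → hom fzero (fsuc j) tt)
      where
      ℓ : Fin n → Point
      ℓ = at ∘ f ∘ fsuc
      dℓ : Distinct ℓ
      dℓ = fsuc-injective ∘ f-inj ∘ at-distinct
      no-centre : ∀ c → ¬ (∀ j → c — ℓ j)
      no-centre (inj₁ i) = clique-degree i ℓ dℓ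
      no-centre (inj₂ u) = spread-degree size≤ u ℓ dℓ

    -- A wheel centred at a clique vertex has its whole rim in F, forming a
    -- cycle of length 2(d+1) inside a single part, which is too small.
    clique-centre : ∀ i (ρ : Fin (suc d * 2) → Point) → Distinct ρ → (∀ j → inj₁ i ≁ ρ j) →
      (∀ j → ρ (inject₁ j) ≁ ρ (fsuc j)) → ⊥
    clique-centre i ρ dρ spoke rim = n≮n _ (part-small (part (ys fzero)) dys same)
      where
      in-F : ∀ x → inj₁ i ≁ x → Σ Vertex λ v → x ≡ inj₂ v
      in-F (inj₁ b) s = ⊥-elim (clique-independent s)
      in-F (inj₂ v) s = v , refl
      ys : Fin (suc d * 2) → Vertex
      ys j = proj₁ (in-F (ρ j) (spoke j))
      ρ≡ : ∀ j → ρ j ≡ inj₂ (ys j)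
      ρ≡ j = proj₂ (in-F (ρ j) (spoke j))
      dys : Distinct ys
      dys = preimage-distinct inj₂ ys ρ≡ dρ
      same : ∀ j → part (ys j) ≡ part (ys fzero)
      same = constant-along (part ∘ ys) λ j →
        part-~ (≁⇒~ (subst₂ _≁_ (ρ≡ (inject₁ j)) (ρ≡ (fsuc j)) (rim j)))

    -- A wheel centred at u ∈ F: each edge of a perfect matching of the rim
    -- has an end in F (the clique is independent in the complement), which
    -- gives d + 1 distinct neighbours of u in F.
    spread-centre : ∀ u (ρ : Fin (suc d * 2) → Point) → Distinct ρ → (∀ j → inj₂ u ≁ ρ j) →
      (∀ j → ρ (combine j fzero) ≁ ρ (combine j (fsuc fzero))) → ⊥
    spread-centre u ρ dρ spoke matched = no-more u (ys , dys , proj₂ ∘ proj₂ ∘ choice)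
      where
      pick : ∀ x y → inj₂ u ≁ x → inj₂ u ≁ y → x ≁ y →
        Σ Vertex λ v → (x ≡ inj₂ v ⊎ y ≡ inj₂ v) × u ~ v
      pick (inj₂ v) y        sx sy m = v , inj₁ refl , ≁⇒~ sx
      pick (inj₁ a) (inj₂ v) sx sy m = v , inj₂ refl , ≁⇒~ sy
      pick (inj₁ a) (inj₁ b) sx sy m = ⊥-elim (clique-independent m)
      choice : ∀ j → Σ Vertex λ v → (ρ (combine j fzero) ≡ inj₂ v ⊎ ρ (combine j (fsuc fzero)) ≡ inj₂ v) × u ~ v
      choice j = pick _ _ (spoke _) (spoke _) (matched j)
      ys : Fin (suc d) → Vertex
      ys = proj₁ ∘ choice
      located : ∀ j → Σ (Fin 2) λ b → ρ (combine j b) ≡ inj₂ (ys j)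
      located j with proj₁ (proj₂ (choice j))
      ... | inj₁ e = fzero , e
      ... | inj₂ e = fsuc fzero , e
      dys : Distinct ys
      dys {j} {j′} e with located j | located j′
      ... | b , ρj | b′ , ρj′ = combine-injectiveˡ j b j′ b′ (dρ (trans ρj (trans (cong inj₂ e) (sym ρj′))))

    no-wheel : ¬ Contains (complement G) (Wheel (suc d * 2))
    no-wheel (f , f-inj , hom) = no-centre (at (f fzero)) (λ j → co-adj fzero (fsuc j) tt)
      where
      co-adj : ∀ a b → Adj (Wheel (suc d * 2)) a b → at (f a) ≁ at (f b)
      co-adj a b w = proj₁ (hom a b w) ∘ at-distinct , proj₂ (hom a b w)
      ρ : Fin (suc d * 2) → Point
      ρ = at ∘ f ∘ fsuc
      dρ : Distinct ρ
      dρ = fsuc-injective ∘ f-inj ∘ at-distinct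
      no-centre : ∀ c → ¬ (∀ j → c ≁ ρ j)
      no-centre (inj₁ i) spoke = clique-centre i ρ dρ spoke λ j → co-adj _ _ (cycle-step j)
      no-centre (inj₂ u) spoke = spread-centre u ρ dρ spoke λ j → co-adj _ _ (cycle-matching j)

lower-bound : ∀ n d {a r} → Spread d a → a ≤ n + d →
  RamseyProp (Star n) (Wheel (suc d * 2)) r → n + a < r
lower-bound n d {a} {r} S a≤ R with r ≤? n + a
... | no r≰ = ≰⇒> r≰
... | yes r≤ = ⊥-elim ([ no-star isSpread size≤ , no-wheel isSpread ]′
                       (ramsey-≥ {Star n} {Wheel (suc d * 2)} R G order≥))
  where
  open Spread S
  open Witness n graph
  size≤ : FinGraph.size graph ≤ n + d
  size≤ = subst (_≤ n + d) (sym has-size) a≤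
  order≥ : r ≤ n + FinGraph.size graph
  order≥ = subst (λ s → r ≤ n + s) (sym has-size) r≤

module Union (F₁ F₂ : FinGraph) where
  module F₁ = FinGraph F₁
  module F₂ = FinGraph F₂

  Vertex : Set
  Vertex = F₁.Vertex ⊎ F₂.Vertex

  _~_ : Vertex → Vertex → Set
  inj₁ x ~ inj₁ y = x F₁.~ y
  inj₁ x ~ inj₂ y = ⊥
  inj₂ x ~ inj₁ y = ⊥
  inj₂ x ~ inj₂ y = x F₂.~ y

  ~-sym : ∀ {u v} → u ~ v → v ~ u
  ~-sym {inj₁ x} {inj₁ y} a = F₁.~-sym a
  ~-sym {inj₂ x} {inj₂ y} a = F₂.~-sym a

  ~-irrefl : ∀ {u} → ¬ u ~ u
  ~-irrefl {inj₁ x} = F₁.~-irrefl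
  ~-irrefl {inj₂ x} = F₂.~-irrefl

  _~?_ : Decidable _~_
  inj₁ x ~? inj₁ y = x F₁.~? y
  inj₁ x ~? inj₂ y = no λ ()
  inj₂ x ~? inj₁ y = no λ ()
  inj₂ x ~? inj₂ y = x F₂.~? y

  graph : FinGraph
  graph = record
    { Vertex = Vertex ; size = F₁.size + F₂.size
    ; indexing = ↔-trans (F₁.indexing ⊎-↔ F₂.indexing) (↔-sym +↔⊎)
    ; _~_ = _~_ ; ~-sym = λ {u v} → ~-sym {u} {v} ; ~-irrefl = λ {u} → ~-irrefl {u}
    ; _~?_ = _~?_ }

  ⊕-spread : ∀ {d} → IsSpread F₁ d → IsSpread F₂ d → IsSpread graph d
  ⊕-spread {d} S₁ S₂ = record
    { nbrs = nbrs ; no-more = no-more ; Part = S₁.Part ⊎ S₂.Part ; part = part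
    ; part-~ = λ {u v} → part-~ {u} {v} ; part-small = part-small }
    where
    module S₁ = IsSpread S₁
    module S₂ = IsSpread S₂

    nbrs : ∀ u → Nbrs graph u d
    nbrs (inj₁ x) = let (xs , dx , adj) = S₁.nbrs x in inj₁ ∘ xs , dx ∘ inj₁-injective , adj
    nbrs (inj₂ x) = let (xs , dx , adj) = S₂.nbrs x in inj₂ ∘ xs , dx ∘ inj₂-injective , adj

    no-more : ∀ u → ¬ Nbrs graph u (suc d)
    no-more (inj₁ x) (xs , dx , adj) =
      S₁.no-more x (ys , preimage-distinct inj₁ ys (proj₁ ∘ proj₂ ∘ side) dx , proj₂ ∘ proj₂ ∘ side)
      where
      on-side : ∀ v → inj₁ x ~ v → Σ F₁.Vertex λ y → v ≡ inj₁ y × x F₁.~ y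
      on-side (inj₁ y) a = y , refl , a
      side : ∀ i → Σ F₁.Vertex λ y → xs i ≡ inj₁ y × x F₁.~ y
      side i = on-side (xs i) (adj i)
      ys = proj₁ ∘ side
    no-more (inj₂ x) (xs , dx , adj) =
      S₂.no-more x (ys , preimage-distinct inj₂ ys (proj₁ ∘ proj₂ ∘ side) dx , proj₂ ∘ proj₂ ∘ side)
      where
      on-side : ∀ v → inj₂ x ~ v → Σ F₂.Vertex λ y → v ≡ inj₂ y × x F₂.~ y
      on-side (inj₂ y) a = y , refl , a
      side : ∀ i → Σ F₂.Vertex λ y → xs i ≡ inj₂ y × x F₂.~ y
      side i = on-side (xs i) (adj i)
      ys = proj₁ ∘ side

    part : Vertex → S₁.Part ⊎ S₂.Part
    part = Sum.map S₁.part S₂.part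

    part-~ : ∀ {u v} → u ~ v → part u ≡ part v
    part-~ {inj₁ x} {inj₁ y} a = cong inj₁ (S₁.part-~ a)
    part-~ {inj₂ x} {inj₂ y} a = cong inj₂ (S₂.part-~ a)

    part-small : ∀ p {m} {xs : Fin m → Vertex} → Distinct xs → (∀ i → part (xs i) ≡ p) → m < suc d * 2
    part-small (inj₁ p) {xs = xs} dx same =
      S₁.part-small p (preimage-distinct inj₁ ys (proj₁ ∘ proj₂ ∘ side) dx) (proj₂ ∘ proj₂ ∘ side)
      where
      on-side : ∀ v → part v ≡ inj₁ p → Σ F₁.Vertex λ y → v ≡ inj₁ y × S₁.part y ≡ p
      on-side (inj₁ y) e = y , refl , inj₁-injective e
      side : ∀ i → Σ F₁.Vertex λ y → xs i ≡ inj₁ y × S₁.part y ≡ p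
      side i = on-side (xs i) (same i)
      ys = proj₁ ∘ side
    part-small (inj₂ p) {xs = xs} dx same =
      S₂.part-small p (preimage-distinct inj₂ ys (proj₁ ∘ proj₂ ∘ side) dx) (proj₂ ∘ proj₂ ∘ side)
      where
      on-side : ∀ v → part v ≡ inj₂ p → Σ F₂.Vertex λ y → v ≡ inj₂ y × S₂.part y ≡ p
      on-side (inj₂ y) e = y , refl , inj₂-injective e
      side : ∀ i → Σ F₂.Vertex λ y → xs i ≡ inj₂ y × S₂.part y ≡ p
      side i = on-side (xs i) (same i)
      ys = proj₁ ∘ side

_⊕_ : ∀ {d a b} → Spread d a → Spread d b → Spread d (a + b)
S₁ ⊕ S₂ = record
  { graph = Union.graph S₁.graph S₂.graph
  ; isSpread = Union.⊕-spread S₁.graph S₂.graph S₁.isSpread S₂.isSpread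
  ; has-size = cong₂ _+_ S₁.has-size S₂.has-size }
  where
  module S₁ = Spread S₁
  module S₂ = Spread S₂

*2≡+ : ∀ x → x * 2 ≡ x + x
*2≡+ x = trans (*-comm x 2) (cong (x +_) (+-identityʳ x))

complete : ℕ → FinGraph
complete k = record
  { Vertex = Fin k ; size = k ; indexing = ↔-refl
  ; _~_ = _≢_ ; ~-sym = ≢-sym ; ~-irrefl = λ ne → ne refl ; _~?_ = λ i j → ¬? (i ≟ j) }

clique : ∀ d → Spread d (suc d)
clique d = record
  { graph = K ; has-size = refl
  ; isSpread = small-spread K (m<m*n (suc d) 2 (s≤s (s≤s z≤n))) nbrs no-more }
  where
  K : FinGraph
  K = complete (suc d)
  nbrs : ∀ u → Nbrs K u d
  nbrs u = punchIn u , punchIn-injective u _ _ , ≢-sym ∘ punchInᵢ≢i u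
  no-more : ∀ u → ¬ Nbrs K u (suc d)
  no-more u nb = n≮n _ (degree-< K nb)

-- The bipartite piece on two copies of Fin p, p = p′ + 1.  Each side is a
-- clique; i on the left and j on the right are adjacent iff the cross-sum
-- (i + j) mod p is at least e.  Every vertex thus has p − 1 neighbours on
-- its own side and p − e on the other side, and exactly e non-neighbours.
module Bipartite (p′ e : ℕ) where
  p : ℕ
  p = suc p′

  σ : Fin p → Fin p → ℕ
  σ i j = (toℕ i + toℕ j) % p

  Far : Fin p → Fin p → Set
  Far i j = e ≤ σ i j

  Far-sym : ∀ {i j} → Far i j → Far j i
  Far-sym {i} {j} = subst (e ≤_) (cong (_% p) (+-comm (toℕ i) (toℕ j)))

  -- The position completing i to cross-sum c (for c < p).
  partner : Fin p → ℕ → Fin p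
  partner i c = (c + (p ∸ toℕ i)) mod p

  σ-partner : ∀ i {c} → c < p → σ i (partner i c) ≡ c
  σ-partner i {c} c<p = begin
    (x + toℕ (partner i c)) % p       ≡⟨ cong (λ z → (x + z) % p) (toℕ-fromℕ< _) ⟩
    (x + (c + (p ∸ x)) % p) % p       ≡⟨ %-distribˡ-+ x _ p ⟩
    (x % p + (c + (p ∸ x)) % p % p) % p ≡⟨ cong (λ z → (x % p + z) % p) (m%n%n≡m%n (c + (p ∸ x)) p) ⟩
    (x % p + (c + (p ∸ x)) % p) % p   ≡⟨ %-distribˡ-+ x _ p ⟨
    (x + (c + (p ∸ x))) % p           ≡⟨ cong (_% p) (rearrange x c (p ∸ x)) ⟩
    (c + (x + (p ∸ x))) % p           ≡⟨ cong (λ z → (c + z) % p) (m+[n∸m]≡n (<⇒≤ (toℕ<n i))) ⟩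
    (c + p) % p                       ≡⟨ [m+n]%n≡m%n c p ⟩
    c % p                             ≡⟨ m<n⇒m%n≡m c<p ⟩
    c                                 ∎
    where
    open ≡-Reasoning
    x = toℕ i
    rearrange : ∀ a b c → a + (b + c) ≡ b + (a + c)
    rearrange a b c = trans (sym (+-assoc a b c)) (trans (cong (_+ c) (+-comm a b)) (+-assoc b a c))

  partners-distinct : ∀ i {c : Fin m → ℕ} (c<p : ∀ j → c j < p) → Distinct c →
    Distinct (λ j → partner i (c j))
  partners-distinct i c<p dc {j} {j′} e =
    dc (trans (sym (σ-partner i (c<p j))) (trans (cong (σ i) e) (σ-partner i (c<p j′))))

  Vertex : Set
  Vertex = Fin p ⊎ Fin p

  _~_ : Vertex → Vertex → Set
  inj₁ i ~ inj₁ j = i ≢ j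
  inj₁ i ~ inj₂ j = Far i j
  inj₂ i ~ inj₁ j = Far i j
  inj₂ i ~ inj₂ j = i ≢ j

  ~-sym : ∀ {u v} → u ~ v → v ~ u
  ~-sym {inj₁ i} {inj₁ j} = ≢-sym
  ~-sym {inj₁ i} {inj₂ j} = Far-sym {i} {j}
  ~-sym {inj₂ i} {inj₁ j} = Far-sym {i} {j}
  ~-sym {inj₂ i} {inj₂ j} = ≢-sym

  ~-irrefl : ∀ {u} → ¬ u ~ u
  ~-irrefl {inj₁ i} ne = ne refl
  ~-irrefl {inj₂ i} ne = ne refl

  _~?_ : Decidable _~_
  inj₁ i ~? inj₁ j = ¬? (i ≟ j)
  inj₁ i ~? inj₂ j = e ≤? σ i j
  inj₂ i ~? inj₁ j = e ≤? σ i j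
  inj₂ i ~? inj₂ j = ¬? (i ≟ j)

  graph : FinGraph
  graph = record
    { Vertex = Vertex ; size = p + p ; indexing = ↔-sym +↔⊎
    ; _~_ = _~_ ; ~-sym = λ {u v} → ~-sym {u} {v} ; ~-irrefl = λ {u} → ~-irrefl {u}
    ; _~?_ = _~?_ }

  module _ (e≤p : e ≤ p) where
    cross : Fin p → Fin (p ∸ e) → Fin p
    cross i j = partner i (e + toℕ j)

    cross-sum<p : ∀ (j : Fin (p ∸ e)) → e + toℕ j < p
    cross-sum<p j = subst (e + toℕ j <_) (m+[n∸m]≡n e≤p) (+-monoʳ-< e (toℕ<n j))

    cross-far : ∀ i j → Far i (cross i j)
    cross-far i j = subst (e ≤_) (sym (σ-partner i (cross-sum<p j))) (m≤m+n e (toℕ j))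

    cross-distinct : ∀ i → Distinct (cross i)
    cross-distinct i = partners-distinct i cross-sum<p (toℕ-injective ∘ +-cancelˡ-≡ e _ _)

    near : Fin p → Fin e → Fin p
    near i j = partner i (toℕ j)

    near-sum<p : ∀ (j : Fin e) → toℕ j < p
    near-sum<p j = <-≤-trans (toℕ<n j) e≤p

    near-close : ∀ i j → ¬ Far i (near i j)
    near-close i j far = <⇒≱ (toℕ<n j) (subst (e ≤_) (σ-partner i (near-sum<p j)) far)

    near-distinct : ∀ i → Distinct (near i)
    near-distinct i = partners-distinct i near-sum<p toℕ-injective

    nbrs : ∀ u → Nbrs graph u (p′ + (p ∸ e))
    nbrs (inj₁ i) =
      (inj₁ ∘ punchIn i) ++ (inj₂ ∘ cross i) ,
      ++-distinct (punchIn-injective i _ _ ∘ inj₁-injective) (cross-distinct i ∘ inj₂-injective) (λ _ _ ()) ,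
      ++-all (inj₁ i ~_) (≢-sym ∘ punchInᵢ≢i i) (cross-far i)
    nbrs (inj₂ i) =
      (inj₂ ∘ punchIn i) ++ (inj₁ ∘ cross i) ,
      ++-distinct (punchIn-injective i _ _ ∘ inj₂-injective) (cross-distinct i ∘ inj₁-injective) (λ _ _ ()) ,
      ++-all (inj₂ i ~_) (≢-sym ∘ punchInᵢ≢i i) (cross-far i)

    nbrs-bound : ∀ {m} u → Nbrs graph u m → m + e < p + p
    nbrs-bound (inj₁ i) nb =
      degree-bound graph nb (inj₂ ∘ near i) (near-distinct i ∘ inj₂-injective) λ j → (λ ()) , near-close i j
    nbrs-bound (inj₂ i) nb =
      degree-bound graph nb (inj₁ ∘ near i) (near-distinct i ∘ inj₁-injective) λ j → (λ ()) , near-close i j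

bipartite : ∀ {d} p′ e → suc p′ + suc p′ ≡ suc d + e → e < suc d → Spread d (suc p′ + suc p′)
bipartite {d} p′ e size≡ e<k = record
  { graph = graph ; has-size = refl
  ; isSpread = small-spread graph size< (λ u → subst (Nbrs graph u) degree≡ (nbrs e≤p u))
                 λ u nb → n≮n _ (subst (_< p + p) (sym size≡) (nbrs-bound e≤p u nb)) }
  where
  open Bipartite p′ e
  e≤p : e ≤ p
  e≤p = <⇒≤ (≰⇒> λ p≤e → <⇒≱ (subst (e + e <_) (sym size≡) (+-monoˡ-< e e<k)) (+-mono-≤ p≤e p≤e))
  degree≡ : p′ + (p ∸ e) ≡ d
  degree≡ = begin
    p′ + (p ∸ e)   ≡⟨ +-∸-assoc p′ e≤p ⟨
    p′ + p ∸ e     ≡⟨ cong (_∸ e) (suc-injective size≡) ⟩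
    d + e ∸ e      ≡⟨ m+n∸n≡m d e ⟩
    d              ∎
    where open ≡-Reasoning
  size< : p + p < suc d * 2
  size< = subst (p + p <_) (sym (*2≡+ (suc d))) (subst (_< suc d + suc d) (sym size≡) (+-monoʳ-< (suc d) e<k))

parity : ∀ x → 2 ∣ x ⊎ 2 ∣ suc x
parity zero = inj₁ (divides 0 refl)
parity (suc x) with parity x
... | inj₁ (divides q x≡) = inj₂ (divides (suc q) (cong (2 +_) x≡))
... | inj₂ even = inj₁ even

¬even-both : ∀ {x} → 2 ∣ x → ¬ 2 ∣ suc x
¬even-both {x} 2∣x 2∣1+x with ∣1⇒≡1 (∣m+n∣m⇒∣n (subst (2 ∣_) (+-comm 1 x) 2∣1+x) 2∣x)
... | ()

even-piece : ∀ d {e} → 2 ∣ suc d + e → e < suc d → Spread d (suc d + e)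
even-piece d {e} (divides (suc p′) size≡) e<k =
  subst (Spread d) (sym size≡′) (bipartite p′ e (sym size≡′) e<k)
  where
  size≡′ : suc d + e ≡ suc p′ + suc p′
  size≡′ = trans size≡ (*2≡+ (suc p′))

-- Between 2k and 3k vertices (k = d + 1 ≥ 2), under the parity condition:
-- two pieces, of sizes k and k + e, or k + 1 and k + e − 1 when k + e is odd.
two-pieces : ∀ d e → 1 ≤ d → e < suc d → (2 ∣ suc d → 2 ∣ suc d + (suc d + e)) →
  Spread d (suc d + (suc d + e))
two-pieces d zero _ _ _ = subst (Spread d) (cong (suc d +_) (sym (+-identityʳ (suc d)))) (clique d ⊕ clique d)
two-pieces d (suc e′) d≥1 e<k parity-k with 2 ∣? (suc d + suc e′)
... | yes even = clique d ⊕ even-piece d even e<k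
... | no odd = subst (Spread d) size≡
                 (even-piece d k+1-even (s≤s d≥1) ⊕ even-piece d k+e′-even (<-trans (n<1+n e′) e<k))
  where
  k+1-even : 2 ∣ suc d + 1
  k+1-even with parity (suc d)
  ... | inj₁ k-even = ⊥-elim (odd (∣m+n∣m⇒∣n (parity-k k-even) k-even))
  ... | inj₂ k+1-even = subst (2 ∣_) (+-comm 1 (suc d)) k+1-even
  k+e′-even : 2 ∣ suc d + e′
  k+e′-even with parity (suc d + e′)
  ... | inj₁ even = even
  ... | inj₂ even = ⊥-elim (odd (subst (2 ∣_) (sym (+-suc (suc d) e′)) even))
  size≡ : suc d + 1 + (suc d + e′) ≡ suc d + (suc d + suc e′)
  size≡ = rearrange d e′
    where
    rearrange : ∀ d e′ → suc d + 1 + (suc d + e′) ≡ suc d + (suc d + suc e′)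
    rearrange = solve-∀

add-cliques : ∀ {d b} q → Spread d b → Spread d (q * suc d + b)
add-cliques zero S = S
add-cliques {d} {b} (suc q) S =
  subst (Spread d) (sym (+-assoc (suc d) (q * suc d) b)) (clique d ⊕ add-cliques q S)

-- Existence of spreads: for k = d + 1 ≥ 2, every a ≥ 2k with a even
-- whenever k is even carries a spread of degree d.  Write a = q·k + (2k + e)
-- with e < k: q cliques and two further pieces.
spread : ∀ d a → 1 ≤ d → suc d * 2 ≤ a → (2 ∣ suc d → 2 ∣ a) → Spread d a
spread d a d≥1 2k≤a parity-a =
  subst (Spread d) (sym a≡) (add-cliques q (two-pieces d (a % k) d≥1 (m%n<n a k) parity-base))
  where
  k : ℕ
  k = suc d
  2≤a/k : 2 ≤ a / k
  2≤a/k = subst (_≤ a / k) (m*n/n≡m 2 k) (/-monoˡ-≤ k (subst (_≤ a) (*-comm k 2) 2k≤a))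
  q : ℕ
  q = proj₁ (m≤n⇒∃[o]m+o≡n 2≤a/k)
  a≡ : a ≡ q * k + (k + (k + a % k))
  a≡ = begin
    a                              ≡⟨ m≡m%n+[m/n]*n a k ⟩
    a % k + a / k * k              ≡⟨ cong (λ z → a % k + z * k) (proj₂ (m≤n⇒∃[o]m+o≡n 2≤a/k)) ⟨
    a % k + (2 + q) * k            ≡⟨ rearrange (a % k) q k ⟩
    q * k + (k + (k + a % k))      ∎
    where
    open ≡-Reasoning
    rearrange : ∀ e q k → e + (2 + q) * k ≡ q * k + (k + (k + e))
    rearrange = solve-∀
  parity-base : 2 ∣ k → 2 ∣ k + (k + a % k)
  parity-base 2∣k = ∣m+n∣m⇒∣n (subst (2 ∣_) a≡ (parity-a 2∣k)) (∣n⇒∣m*n q 2∣k)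

below : ∀ k n → 0 < k → k * 2 ≤ 2 * n ∸ 2 → k < n
below (suc k) zero    _ ()
below (suc k) (suc n) _ 2k≤ = *-cancelʳ-≤ (suc (suc k)) (suc n) 2 (begin
    suc (suc k) * 2   ≡⟨ +-comm 2 (suc k * 2) ⟩
    suc k * 2 + 2     ≤⟨ m≤o∸n⇒m+n≤o (suc k * 2) (*-monoʳ-≤ 2 (s≤s z≤n)) 2k≤ ⟩
    2 * suc n         ≡⟨ *-comm 2 (suc n) ⟩
    suc n * 2         ∎)
  where open ≤-Reasoning

-- Case of the theorem where n and k = d′ + 2 are both even: a spread on
-- n + k − 2 vertices gives R ≥ 2n + k − 1.
bound-both-even : ∀ n d′ {r} → 2 ∣ n → 2 ∣ suc (suc d′) → suc (suc d′) < n →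
  RamseyProp (Star n) (Wheel (suc (suc d′) * 2)) r → 2 * n + suc (suc d′) ∸ 1 ≤ r
bound-both-even n d′ {r} 2∣n 2∣k k<n R = subst (_≤ r) (cong (_∸ 1) (count n d′))
  (lower-bound n (suc d′) (spread (suc d′) (n + d′) (s≤s z≤n) 2k≤a parity-a) (+-monoʳ-≤ n (n≤1+n d′)) R)
  where
  -- n ≠ k + 1, as k + 1 is odd
  k+1<n : suc (suc (suc d′)) < n
  k+1<n with m≤n⇒m<n∨m≡n k<n
  ... | inj₁ k+1<n = k+1<n
  ... | inj₂ refl = ⊥-elim (¬even-both 2∣k 2∣n)
  2k≤a : suc (suc d′) * 2 ≤ n + d′
  2k≤a = subst (_≤ n + d′) (double d′) (+-monoˡ-≤ d′ k+1<n)
    where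
    double : ∀ d′ → 4 + d′ + d′ ≡ suc (suc d′) * 2
    double = solve-∀
  parity-a : 2 ∣ suc (suc d′) → 2 ∣ n + d′
  parity-a 2∣k = ∣m∣n⇒∣m+n 2∣n (∣m+n∣m⇒∣n 2∣k ∣-refl)
  count : ∀ n d′ → 2 + (n + (n + d′)) ≡ 2 * n + suc (suc d′)
  count = solve-∀

-- Remaining case, n odd or k = d + 1 odd: a spread on n + k − 1 vertices
-- gives R ≥ 2n + k.
bound-otherwise : ∀ n d {r} → 1 ≤ d → suc d < n → (2 ∣ suc d → ¬ 2 ∣ n) →
  RamseyProp (Star n) (Wheel (suc d * 2)) r → 2 * n + suc d ≤ r
bound-otherwise n d {r} d≥1 k<n n-odd R = subst (_≤ r) (count n d)
  (lower-bound n d (spread d (n + d) d≥1 2k≤a parity-a) ≤-refl R)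
  where
  2k≤a : suc d * 2 ≤ n + d
  2k≤a = subst (_≤ n + d) (double d) (+-monoˡ-≤ d k<n)
    where
    double : ∀ d → 2 + d + d ≡ suc d * 2
    double = solve-∀
  parity-a : 2 ∣ suc d → 2 ∣ n + d
  parity-a 2∣k with parity n
  ... | inj₁ 2∣n = ⊥-elim (n-odd 2∣k 2∣n)
  ... | inj₂ 2∣n+1 = ∣m+n∣m⇒∣n (subst (2 ∣_) (+-suc (suc n) d) (∣m∣n⇒∣m+n 2∣n+1 2∣k)) ∣-refl
  count : ∀ n d → suc (n + (n + d)) ≡ 2 * n + suc d
  count = solve-∀

half : ∀ k → k * 2 / 2 ≡ k
half k = m*n/n≡m k 2

theorem3 : ∀ (n m : ℕ) → 2 ∣ m → 6 ≤ m → m ≤ 2 * n ∸ 2 →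
    ∀ (r : ℕ) → RamseyProp (Star n) (Wheel m) r →
      ((2 ∣ n × 2 ∣ (m / 2)) → 2 * n + m / 2 ∸ 1 ≤ r) ×
      (¬ (2 ∣ n × 2 ∣ (m / 2)) → 2 * n + m / 2 ≤ r)
theorem3 n .(0 * 2) (divides 0 refl) ()
theorem3 n .(1 * 2) (divides 1 refl) (s≤s (s≤s ()))
theorem3 n .(2 * 2) (divides 2 refl) (s≤s (s≤s (s≤s (s≤s ()))))
theorem3 n .(suc (suc (suc j)) * 2) (divides (suc (suc (suc j))) refl) _ 2k≤ r R
  rewrite half (suc (suc (suc j))) =
    (λ (2∣n , 2∣k) → bound-both-even n (suc j) 2∣n 2∣k k<n R) ,
    (λ not-both → bound-otherwise n (suc (suc j)) (s≤s z≤n) k<n (λ 2∣k 2∣n → not-both (2∣n , 2∣k)) R)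
  where
  k<n : suc (suc (suc j)) < n
  k<n = below _ n (s≤s z≤n) 2k≤
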